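{- Let $G$ be a model of $T_{fg}$, let $a\in G$ with $a\neq1$, and let $B=C(a)$. Then $\bigcup_{g\in G}B^g$ is not generic in $G$.
   Context: $T_{fg}$ is the common complete theory, in the language of groups, of the free groups $F_n$, $n\ge2$. $C(a)$ is the centralizer of $a$ and $B^g=g^{ -1}Bg$. A definable subset of $G$ is generic if finitely many left translates of it cover $G$. -}

module Defs where

open import Level using (Level; _⊔_; 0ℓ)
open import Data.Nat using (ℕ; suc)
open import Data.Fin using (Fin; zero; suc; _≟_)
open import Data.Bool using (Bool; true; false; not; _∧_; if_then_else_)
open import Data.Bool.Properties renaming (_≟_ to _≟ᵇ_)
open import Data.List using (List; []; _∷_; _++_; reverse; map; foldr)
open import Data.Product using (Σ; _×_; _,_; ∃)
open import Data.Empty using (⊥)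
open import Relation.Nullary using (¬_; does)
open import Relation.Binary.PropositionalEquality using (_≡_)
open import Function.Bundles using (_⇔_)
open import Algebra.Bundles using (Group)

data Term (n : ℕ) : Set where
  var  : Fin n → Term n
  one  : Term n
  _·_  : Term n → Term n → Term n
  inv  : Term n → Term n

-- Formulas with n free variables (de Bruijn).  ∨, ∃ are taken as
-- classical abbreviations (¬ ∧ ¬, ¬ ∀ ¬), so this primitive set suffices.
data Formula : ℕ → Set where
  _≐_  : ∀ {n} → Term n → Term n → Formula n
  ff   : ∀ {n} → Formula n
  _⇒_  : ∀ {n} → Formula n → Formula n → Formula n
  _&_  : ∀ {n} → Formula n → Formula n → Formula n
  all  : ∀ {n} → Formula (suc n) → Formula n

Sentence : Set
Sentence = Formula 0

record GStructure (c ℓ : Level) : Set (Level.suc (c ⊔ ℓ)) where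
  field
    Carrier : Set c
    _≈_     : Carrier → Carrier → Set ℓ
    _∙_     : Carrier → Carrier → Carrier
    e       : Carrier
    _⁻¹     : Carrier → Carrier

module Semantics {c ℓ} (M : GStructure c ℓ) where
  open GStructure M

  evalT : ∀ {n} → (Fin n → Carrier) → Term n → Carrier
  evalT ρ (var i) = ρ i
  evalT ρ one = e
  evalT ρ (t · s) = evalT ρ t ∙ evalT ρ s
  evalT ρ (inv t) = evalT ρ t ⁻¹

  extend : ∀ {n} → Carrier → (Fin n → Carrier) → Fin (suc n) → Carrier
  extend x ρ zero = x
  extend x ρ (suc i) = ρ i

  -- Classical (Tarski) satisfaction, rendered constructively via the
  -- Goedel-Gentzen negative translation (atoms are double-negated).
  Sat : ∀ {n} → (Fin n → Carrier) → Formula n → Set (c ⊔ ℓ)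
  Sat ρ (t ≐ s) = ¬ ¬ Level.Lift c (evalT ρ t ≈ evalT ρ s)
  Sat ρ ff = Level.Lift (c ⊔ ℓ) ⊥
  Sat ρ (φ ⇒ ψ) = Sat ρ φ → Sat ρ ψ
  Sat ρ (φ & ψ) = Sat ρ φ × Sat ρ ψ
  Sat ρ (all φ) = (x : Carrier) → Sat (extend x ρ) φ

  noVars : Fin 0 → Carrier
  noVars ()

  _⊨_ : Sentence → Set (c ⊔ ℓ)
  _⊨_ φ = Sat noVars φ

Letter : Set
Letter = Fin 2 × Bool     -- (generator, exponent sign: true = +1)

invL : Letter → Letter
invL (i , b) = (i , not b)

inverseLetters : Letter → Letter → Bool
inverseLetters (i , b) (j , b') = does (i ≟ j) ∧ does (b ≟ᵇ not b')

-- one step of right-to-left free reduction onto an already reduced word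
push : Letter → List Letter → List Letter
push x [] = x ∷ []
push x (y ∷ ys) = if inverseLetters x y then ys else (x ∷ y ∷ ys)

reduce : List Letter → List Letter
reduce = foldr push []

F₂ : GStructure 0ℓ 0ℓ
F₂ = record
  { Carrier = List Letter
  ; _≈_ = λ u v → reduce u ≡ reduce v
  ; _∙_ = _++_
  ; e = []
  ; _⁻¹ = λ w → reverse (map invL w)
  }

groupStructure : ∀ {c ℓ} → Group c ℓ → GStructure c ℓ
groupStructure G = record
  { Carrier = Carrier ; _≈_ = _≈_ ; _∙_ = _∙_ ; e = ε ; _⁻¹ = _⁻¹ }
  where open Group G

-- G is a model of T_fg = Th(F₂) (= Th(F_n) for all n ≥ 2):
-- G is elementarily equivalent to F₂.
ModelOfTfg : ∀ {c ℓ} → Group c ℓ → Set (c ⊔ ℓ)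
ModelOfTfg G = (φ : Sentence) →
  Semantics._⊨_ (groupStructure G) φ ⇔ Semantics._⊨_ F₂ φ

module _ {c ℓ} (G : Group c ℓ) where
  open Group G

  Centralizer : Carrier → Carrier → Set ℓ
  Centralizer a b = b ∙ a ≈ a ∙ b

  UnionOfConjugates : (Carrier → Set ℓ) → Carrier → Set (c ⊔ ℓ)
  UnionOfConjugates B x = ∃ λ g → ∃ λ b → B b × (x ≈ (g ⁻¹ ∙ b) ∙ g)

  -- X is generic: finitely many left translates h_i X cover G.
  -- (x ∈ h X  iff  h⁻¹ x ∈ X; the covering existential is classical,
  -- hence double-negated.)
  Generic : (Carrier → Set (c ⊔ ℓ)) → Set (c ⊔ ℓ)
  Generic X = Σ ℕ λ n → Σ (Fin n → Carrier) λ h →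
    (x : Carrier) → ¬ ¬ (∃ λ i → X (h i ⁻¹ ∙ x))

{-# OPTIONS --safe #-}

-- Each Ψ n below is a first-order sentence saying that for every a ≠ 1 no n
-- left translates of X = ⋃_g C(a)^g cover the group, so a model of T_fg
-- satisfies it as soon as F₂ does. In F₂ let k = |a|, K > |hᵢ| for all i and
-- x = α^K (α^{2k} β^{2k})² β^K. Write a = P s P⁻¹ with s cyclically reduced
-- and nonempty. If hᵢ⁻¹x = g⁻¹bg with b ∈ C(a), then a reduced conjugate w of
-- hᵢ⁻¹x commutes with s, and its cyclic core, a rotation of that of hᵢ⁻¹x,
-- still contains runs α^{2k} and β^{2k}. A reduced word commuting with a long
-- power s^M is π σ⁻¹ with π, σ prefixes of s^M, so half of each run, of length
-- k ≥ |s|, lies in s^M or its inverse; hence every letter of s is α^{±1}, and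
-- likewise β^{±1}, which is absurd.

module Submission where

open import Defs
open import Algebra.Bundles using (Group)
open import Level using (Level; lift; lower; 0ℓ) renaming (_⊔_ to _⊔ˡ_)
open import Data.Bool using (true; false; not)
open import Data.Bool.Properties using (not-involutive; ∧-zeroʳ) renaming (_≟_ to _≟ᵇ_)
open import Data.Empty using (⊥-elim)
open import Data.Fin using (Fin; zero; suc; _≟_)
open import Data.Nat using (ℕ; zero; suc; _+_; _*_; _≤_; _<_; _≤?_; _⊔_; s≤s; z≤n)
open import Data.Nat.Properties hiding (_≟_)
open import Data.List
  using (List; []; _∷_; _++_; [_]; reverse; map; foldr; length; replicate; _∷ʳ_; initLast; _∷ʳ′_)
open import Data.List.Properties
open import Data.List.Relation.Unary.All using (All; []; _∷_)
import Data.List.Relation.Unary.All as All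
import Data.List.Relation.Unary.All.Properties as All
open import Data.List.Relation.Unary.Linked using (Linked; []; [-]; _∷_; head; tail)
open import Data.Product using (_×_; _,_; ∃; ∃₂; proj₁; proj₂)
open import Data.Sum using (_⊎_; inj₁; inj₂)
open import Function using (id; _∘_; _⇔_; mk⇔; Equivalence)
open import Relation.Binary.Bundles using (Setoid)
open import Relation.Binary.PropositionalEquality hiding ([_])
import Relation.Binary.Reasoning.Setoid as SetoidReasoning
open import Relation.Binary.Structures using (IsEquivalence)
open import Relation.Nullary using (¬_; yes; no; contradiction)
open import Tactic.MonoidSolver using (solve)

infix 25 ¬ᶠ_
¬ᶠ_ : ∀ {n} → Formula n → Formula n
¬ᶠ φ = φ ⇒ ff

∃ᶠ : ∀ {n} → Formula (suc n) → Formula n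
∃ᶠ φ = ¬ᶠ all (¬ᶠ φ)

∀ⁿ : ∀ n → Formula n → Sentence
∀ⁿ zero φ = φ
∀ⁿ (suc n) φ = ∀ⁿ n (all φ)

⋀ : ∀ {m} n → (Fin n → Formula m) → Formula m
⋀ zero _ = ¬ᶠ ff
⋀ (suc n) φ = φ zero & ⋀ n (φ ∘ suc)

-- hᵢ⁻¹ x lies in a conjugate of C(a), for x = var 0, a = var 1, hᵢ = var (2 + i)
InConjugateᶠ : ∀ {n} → Fin n → Formula (suc (suc n))
InConjugateᶠ {n} i = ∃ᶠ (∃ᶠ (((b · a) ≐ (a · b)) & ((inv h · x) ≐ ((inv g · b) · g))))
  where
  b g x a h : Term (suc (suc (suc (suc n))))
  b = var zero
  g = var (suc zero)
  x = var (suc (suc zero))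
  a = var (suc (suc (suc zero)))
  h = var (suc (suc (suc (suc i))))

-- ∀ a h₁ … hₙ. a ≠ 1 → ∃ x. ⋀ᵢ ¬ (hᵢ⁻¹ x ∈ ⋃_g C(a)^g)
Ψ : ℕ → Sentence
Ψ n = ∀ⁿ (suc n) (¬ᶠ (¬ᶠ (var zero ≐ one) & all (¬ᶠ ⋀ n (¬ᶠ_ ∘ InConjugateᶠ))))

module _ {c ℓ} (M : GStructure c ℓ) where
  open GStructure M
  open Semantics M

  InConjugateOfCentralizer : Carrier → Carrier → Set (c ⊔ˡ ℓ)
  InConjugateOfCentralizer a x = ∃ λ g → ∃ λ b → ((b ∙ a) ≈ (a ∙ b)) × (x ≈ (((g ⁻¹) ∙ b) ∙ g))

  TranslatesCover : ∀ {n} → (Carrier → Set (c ⊔ˡ ℓ)) → (Fin n → Carrier) → Set (c ⊔ˡ ℓ)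
  TranslatesCover X h = (x : Carrier) → ¬ ¬ (∃ λ i → X ((h i ⁻¹) ∙ x))

  evalT-cong : ∀ {n} {ρ ρ′ : Fin n → Carrier} → (∀ i → ρ i ≡ ρ′ i) →
    ∀ t → evalT ρ t ≡ evalT ρ′ t
  evalT-cong ρ≗ρ′ (var i) = ρ≗ρ′ i
  evalT-cong ρ≗ρ′ one = refl
  evalT-cong ρ≗ρ′ (t · s) = cong₂ _∙_ (evalT-cong ρ≗ρ′ t) (evalT-cong ρ≗ρ′ s)
  evalT-cong ρ≗ρ′ (inv t) = cong _⁻¹ (evalT-cong ρ≗ρ′ t)

  Sat-cong : ∀ {n} {ρ ρ′ : Fin n → Carrier} → (∀ i → ρ i ≡ ρ′ i) →
    ∀ φ → Sat ρ φ → Sat ρ′ φ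
  Sat-cong ρ≗ρ′ (t ≐ s) rewrite evalT-cong ρ≗ρ′ t | evalT-cong ρ≗ρ′ s = id
  Sat-cong ρ≗ρ′ ff = id
  Sat-cong ρ≗ρ′ (φ ⇒ ψ) sat = Sat-cong ρ≗ρ′ ψ ∘ sat ∘ Sat-cong (sym ∘ ρ≗ρ′) φ
  Sat-cong ρ≗ρ′ (φ & ψ) (satφ , satψ) = Sat-cong ρ≗ρ′ φ satφ , Sat-cong ρ≗ρ′ ψ satψ
  Sat-cong ρ≗ρ′ (all φ) sat x = Sat-cong (λ { zero → refl ; (suc i) → ρ≗ρ′ i }) φ (sat x)

  ∀ⁿ-intro : ∀ n {φ} → (∀ ρ → Sat ρ φ) → _⊨_ (∀ⁿ n φ)
  ∀ⁿ-intro zero sat = sat noVars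
  ∀ⁿ-intro (suc n) sat = ∀ⁿ-intro n (λ ρ x → sat (extend x ρ))

  ∀ⁿ-elim : ∀ n {φ} → _⊨_ (∀ⁿ n φ) → ∀ ρ → Sat ρ φ
  ∀ⁿ-elim zero {φ} sat ρ = Sat-cong (λ ()) φ sat
  ∀ⁿ-elim (suc n) {φ} sat ρ =
    Sat-cong (λ { zero → refl ; (suc i) → refl }) φ (∀ⁿ-elim n sat (ρ ∘ suc) (ρ zero))

  ⋀-intro : ∀ {m} n {φ : Fin n → Formula m} {ρ} → (∀ i → Sat ρ (φ i)) → Sat ρ (⋀ n φ)
  ⋀-intro zero _ = id
  ⋀-intro (suc n) sat = sat zero , ⋀-intro n (sat ∘ suc)

  ⋀-elim : ∀ {m} n {φ : Fin n → Formula m} {ρ} → Sat ρ (⋀ n φ) → ∀ i → Sat ρ (φ i)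
  ⋀-elim (suc n) (sat , _) zero = sat
  ⋀-elim (suc n) (_ , sat) (suc i) = ⋀-elim n sat i

  InConjugateᶠ-intro : ∀ {n} ρ (i : Fin n) {x} → InConjugateOfCentralizer (ρ zero) ((ρ (suc i) ⁻¹) ∙ x) →
    Sat (extend x ρ) (InConjugateᶠ i)
  InConjugateᶠ-intro ρ i (g , b , commute , conjugate) none =
    none g λ none′ → none′ b ((λ ¬commute → ¬commute (lift commute)) ,
                              (λ ¬conjugate → ¬conjugate (lift conjugate)))

  InConjugateᶠ-elim : ∀ {n} ρ (i : Fin n) {x} → Sat (extend x ρ) (InConjugateᶠ i) →
    ¬ ¬ InConjugateOfCentralizer (ρ zero) ((ρ (suc i) ⁻¹) ∙ x)
  InConjugateᶠ-elim ρ i sat ¬in = lower (sat λ g none → none λ b (commute , conjugate) →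
    lift (commute λ commute′ → conjugate λ conjugate′ → ¬in (g , b , lower commute′ , lower conjugate′)))

  CentralizerConjugatesNotCovered : ℕ → Set (c ⊔ˡ ℓ)
  CentralizerConjugatesNotCovered n =
    ∀ a → ¬ a ≈ e → (h : Fin n → Carrier) → ¬ TranslatesCover (InConjugateOfCentralizer a) h

  ⊨Ψ⇔CentralizerConjugatesNotCovered : ∀ n → _⊨_ (Ψ n) ⇔ CentralizerConjugatesNotCovered n
  ⊨Ψ⇔CentralizerConjugatesNotCovered n = mk⇔ to from
    where
    to : _⊨_ (Ψ n) → CentralizerConjugatesNotCovered n
    to sat a a≉e h cover = lower (∀ⁿ-elim (suc n) sat ρ (a≠1 , no-escape))
      where
      ρ : Fin (suc n) → Carrier
      ρ zero = a
      ρ (suc i) = h i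
      a≠1 : Sat ρ (¬ᶠ (var zero ≐ one))
      a≠1 ¬¬a≈e = ⊥-elim (¬¬a≈e (a≉e ∘ lower))
      no-escape : Sat ρ (all (¬ᶠ ⋀ n (¬ᶠ_ ∘ InConjugateᶠ)))
      no-escape x all-escape = ⊥-elim (cover x λ (i , in-conjugate) →
        lower (⋀-elim n all-escape i (InConjugateᶠ-intro ρ i in-conjugate)))
    from : CentralizerConjugatesNotCovered n → _⊨_ (Ψ n)
    from no-cover = ∀ⁿ-intro (suc n) λ ρ (a≠1 , no-escape) →
      ⊥-elim (no-cover (ρ zero) (λ a≈e → lower (a≠1 (λ ¬a≈e → ¬a≈e (lift a≈e)))) (ρ ∘ suc)
        λ x ¬escape →
        lower (no-escape x (⋀-intro n λ i in-conjugate →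
          lift (InConjugateᶠ-elim ρ i in-conjugate (λ in-conjugate′ → ¬escape (i , in-conjugate′))))))

module _ {a : Level} {A : Set a} where

  Prefix : List A → List A → Set a
  Prefix xs zs = ∃ λ ys → zs ≡ xs ++ ys

  Infix : List A → List A → Set a
  Infix xs zs = ∃₂ λ ls rs → zs ≡ ls ++ xs ++ rs

  ∷-∷ʳ : ∀ (y : A) ys → ∃₂ λ xs z → y ∷ ys ≡ xs ∷ʳ z
  ∷-∷ʳ y ys with initLast ys
  ... | []       = [] , y , refl
  ... | xs ∷ʳ′ z = y ∷ xs , z , refl

  replicate-+ : ∀ m n (x : A) → replicate (m + n) x ≡ replicate m x ++ replicate n x
  replicate-+ zero n x = refl
  replicate-+ (suc m) n x = cong (x ∷_) (replicate-+ m n x)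

  ++-split : ∀ (xs ys us vs : List A) → xs ++ ys ≡ us ++ vs →
    (∃ λ m → us ≡ xs ++ m × ys ≡ m ++ vs) ⊎ (∃ λ m → xs ≡ us ++ m × vs ≡ m ++ ys)
  ++-split [] ys us vs eq = inj₁ (us , refl , eq)
  ++-split (x ∷ xs) ys [] vs eq = inj₂ (x ∷ xs , refl , sym eq)
  ++-split (x ∷ xs) ys (u ∷ us) vs eq with ∷-injective eq
  ... | refl , eq′ with ++-split xs ys us vs eq′
  ...   | inj₁ (m , us≡ , ys≡) = inj₁ (m , cong (x ∷_) us≡ , ys≡)
  ...   | inj₂ (m , xs≡ , vs≡) = inj₂ (m , cong (x ∷_) xs≡ , vs≡)

  ++-split-≤ : ∀ (xs ys us vs : List A) → length xs ≤ length us → xs ++ ys ≡ us ++ vs →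
    ∃ λ m → us ≡ xs ++ m × ys ≡ m ++ vs
  ++-split-≤ [] ys us vs _ eq = us , refl , eq
  ++-split-≤ (x ∷ xs) ys (u ∷ us) vs (s≤s xs≤us) eq with ∷-injective eq
  ... | refl , eq′ with ++-split-≤ xs ys us vs xs≤us eq′
  ...   | m , us≡ , ys≡ = m , cong (x ∷_) us≡ , ys≡

  ++-split-≤ʳ : ∀ (xs ys us vs : List A) → length ys ≤ length vs → xs ++ ys ≡ us ++ vs →
    ∃ λ m → vs ≡ m ++ ys × xs ≡ us ++ m
  ++-split-≤ʳ xs ys us vs ys≤vs eq with ++-split-≤ us vs xs ys us≤xs (sym eq)
    where
    us≤xs : length us ≤ length xs
    us≤xs = +-cancelʳ-≤ (length ys) (length us) (length xs) (begin
      length us + length ys ≤⟨ +-monoʳ-≤ (length us) ys≤vs ⟩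
      length us + length vs ≡⟨ length-++ us ⟨
      length (us ++ vs)     ≡⟨ cong length eq ⟨
      length (xs ++ ys)     ≡⟨ length-++ xs ⟩
      length xs + length ys ∎)
      where open ≤-Reasoning
  ... | m , xs≡ , vs≡ = m , vs≡ , xs≡

  Infix-++-split : ∀ ls (xs ys : List A) rs us vs → ls ++ xs ++ ys ++ rs ≡ us ++ vs → Infix xs us ⊎ Infix ys vs
  Infix-++-split ls xs ys rs us vs eq with ++-split (ls ++ xs) (ys ++ rs) us vs (trans (++-assoc ls xs (ys ++ rs)) eq)
  ... | inj₁ (m , us≡ , _) = inj₁ (ls , m , trans us≡ (++-assoc ls xs m))
  ... | inj₂ (m , _ , vs≡) = inj₂ (m , rs , vs≡)

  Infix-prefix : ∀ {xs ys zs : List A} → Infix xs ys → Prefix ys zs → Infix xs zs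
  Infix-prefix (ls , rs , refl) (rs′ , refl) = ls , rs ++ rs′ , solve (++-monoid A)

  Infix-++⁺ : ∀ {xs ys : List A} us vs → Infix xs ys → Infix xs (us ++ ys ++ vs)
  Infix-++⁺ us vs (ls , rs , refl) = us ++ ls , rs ++ vs , solve (++-monoid A)

  module _ {p : Level} {P : A → Set p} where

    All-prefix : ∀ xs {ys us vs} → xs ++ ys ≡ us ++ vs → length xs ≤ length us → All P us → All P xs
    All-prefix xs {ys} {us} {vs} eq xs≤us pus with ++-split-≤ xs ys us vs xs≤us eq
    ... | m , refl , _ = All.++⁻ˡ xs pus

    All-infix : ∀ {xs zs} → Infix xs zs → All P zs → All P xs
    All-infix {xs} (ls , rs , refl) pzs = All.++⁻ˡ xs (All.++⁻ʳ ls pzs)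

  module _ {r : Level} {R : A → A → Set r} where

    Linked-++⁻ˡ : ∀ xs {ys} → Linked R (xs ++ ys) → Linked R xs
    Linked-++⁻ˡ [] _ = []
    Linked-++⁻ˡ (x ∷ []) _ = [-]
    Linked-++⁻ˡ (x ∷ y ∷ xs) (p ∷ l) = p ∷ Linked-++⁻ˡ (y ∷ xs) l

    Linked-++⁻ʳ : ∀ xs {ys} → Linked R (xs ++ ys) → Linked R ys
    Linked-++⁻ʳ [] l = l
    Linked-++⁻ʳ (x ∷ xs) l = Linked-++⁻ʳ xs (tail l)

    Linked-infix : ∀ xs ys {zs} → Linked R (xs ++ ys ++ zs) → Linked R ys
    Linked-infix xs ys = Linked-++⁻ˡ ys ∘ Linked-++⁻ʳ xs

    Linked-glue : ∀ xs {y} ys zs →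
      Linked R (xs ++ y ∷ ys) → Linked R (y ∷ ys ++ zs) → Linked R (xs ++ y ∷ ys ++ zs)
    Linked-glue [] ys zs _ l = l
    Linked-glue (x ∷ []) ys zs (p ∷ _) l = p ∷ l
    Linked-glue (x ∷ x′ ∷ xs) ys zs (p ∷ l′) l = p ∷ Linked-glue (x′ ∷ xs) ys zs l′ l

invL-involutive : ∀ x → invL (invL x) ≡ x
invL-involutive (i , b) = cong (i ,_) (not-involutive b)

NoCancel : Letter → Letter → Set
NoCancel x y = inverseLetters x y ≡ false

inverseLetters⇒≡invL : ∀ x y → inverseLetters x y ≡ true → y ≡ invL x
inverseLetters⇒≡invL (i , b) (j , b′) h with i ≟ j | b ≟ᵇ not b′
... | yes refl | yes refl = cong (i ,_) (sym (not-involutive b′))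
inverseLetters⇒≡invL (i , b) (j , b′) () | yes _ | no _
inverseLetters⇒≡invL (i , b) (j , b′) () | no _  | _

inverseLetters-invL : ∀ x → inverseLetters x (invL x) ≡ true
inverseLetters-invL (zero , true) = refl
inverseLetters-invL (zero , false) = refl
inverseLetters-invL (suc zero , true) = refl
inverseLetters-invL (suc zero , false) = refl

inverseLetters-irrefl : ∀ x → NoCancel x x
inverseLetters-irrefl (zero , true) = refl
inverseLetters-irrefl (zero , false) = refl
inverseLetters-irrefl (suc zero , true) = refl
inverseLetters-irrefl (suc zero , false) = refl

NoCancel-invL-swap : ∀ x y → NoCancel (invL x) y → NoCancel (invL y) x
NoCancel-invL-swap x y nc with inverseLetters (invL y) x in e
... | false = refl
... | true = contradiction (trans (sym cancels) nc) λ ()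
  where
  x≡y : x ≡ y
  x≡y = trans (inverseLetters⇒≡invL (invL y) x e) (invL-involutive y)
  cancels : inverseLetters (invL x) y ≡ true
  cancels = subst (λ z → inverseLetters (invL x) z ≡ true) (trans (invL-involutive x) x≡y)
                  (inverseLetters-invL (invL x))

Word : Set
Word = List Letter

infix 10 _⁻¹
_⁻¹ : Word → Word
w ⁻¹ = reverse (map invL w)

⁻¹-++ : ∀ u v → (u ++ v) ⁻¹ ≡ v ⁻¹ ++ u ⁻¹
⁻¹-++ u v = trans (cong reverse (map-++ invL u v)) (reverse-++ (map invL u) (map invL v))

⁻¹-∷ : ∀ x w → (x ∷ w) ⁻¹ ≡ w ⁻¹ ++ [ invL x ]
⁻¹-∷ x w = ⁻¹-++ [ x ] w

⁻¹-involutive : ∀ w → w ⁻¹ ⁻¹ ≡ w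
⁻¹-involutive w = begin
  reverse (map invL (reverse (map invL w))) ≡⟨ cong reverse (reverse-map invL (map invL w)) ⟩
  reverse (reverse (map invL (map invL w))) ≡⟨ reverse-involutive _ ⟩
  map invL (map invL w)                     ≡⟨ map-∘ w ⟨
  map (invL ∘ invL) w                       ≡⟨ map-cong invL-involutive w ⟩
  map id w                                  ≡⟨ map-id w ⟩
  w                                         ∎
  where open ≡-Reasoning

length-⁻¹ : ∀ w → length (w ⁻¹) ≡ length w
length-⁻¹ w = trans (length-reverse (map invL w)) (length-map invL w)

∷-conjugate : ∀ y P t → (y ∷ P) ++ t ++ (y ∷ P) ⁻¹ ≡ (y ∷ P ++ t ++ P ⁻¹) ++ [ invL y ]
∷-conjugate y P t rewrite ⁻¹-∷ y P = cong (y ∷_) (solve (++-monoid Letter))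

conjugate-by-++ : ∀ u v Q → (u ++ v) ⁻¹ ++ Q ++ (u ++ v) ≡ v ⁻¹ ++ (u ⁻¹ ++ Q ++ u) ++ v
conjugate-by-++ u v Q rewrite ⁻¹-++ u v = solve (++-monoid Letter)

Reduced : Word → Set
Reduced = Linked NoCancel

push-reduced : ∀ x {w} → Reduced w → Reduced (push x w)
push-reduced x {[]} _ = [-]
push-reduced x {y ∷ w} r with inverseLetters x y in e
... | true  = tail r
... | false = e ∷ r

reduce-reduced : ∀ w → Reduced (reduce w)
reduce-reduced [] = []
reduce-reduced (x ∷ w) = push-reduced x (reduce-reduced w)

push-noCancel : ∀ {x y} w → NoCancel x y → push x (y ∷ w) ≡ x ∷ y ∷ w
push-noCancel w nc rewrite nc = refl

push-reduced-∷ : ∀ {x w} → Reduced (x ∷ w) → push x w ≡ x ∷ w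
push-reduced-∷ {w = []} _ = refl
push-reduced-∷ {w = y ∷ w} (nc ∷ _) = push-noCancel w nc

reduced⇒reduce≡id : ∀ {w} → Reduced w → reduce w ≡ w
reduced⇒reduce≡id {[]} _ = refl
reduced⇒reduce≡id {x ∷ w} r = trans (cong (push x) (reduced⇒reduce≡id (tail r))) (push-reduced-∷ r)

push-invL-cancel : ∀ x {w} → Reduced w → push x (push (invL x) w) ≡ w
push-invL-cancel x {[]} _ rewrite inverseLetters-invL x = refl
push-invL-cancel x {y ∷ w} r with inverseLetters (invL x) y in e
... | true  = subst (λ z → push z w ≡ y ∷ w) y≡x (push-reduced-∷ r)
  where
  y≡x : y ≡ x
  y≡x = trans (inverseLetters⇒≡invL (invL x) y e) (invL-involutive x)
... | false rewrite inverseLetters-invL x = refl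

pushAll : Word → Word → Word
pushAll u w = foldr push w u

pushAll-reduced : ∀ u {w} → Reduced w → Reduced (pushAll u w)
pushAll-reduced [] r = r
pushAll-reduced (x ∷ u) r = push-reduced x (pushAll-reduced u r)

reduce-++ : ∀ u v → reduce (u ++ v) ≡ pushAll u (reduce v)
reduce-++ u v = foldr-++ push [] u v

pushAll-push : ∀ x w {v} → Reduced v → pushAll (push x w) v ≡ push x (pushAll w v)
pushAll-push x [] _ = refl
pushAll-push x (y ∷ w) {v} r with inverseLetters x y in e
... | false = refl
... | true  = sym (subst (λ z → push x (push z (pushAll w v)) ≡ pushAll w v)
                        (sym (inverseLetters⇒≡invL x y e)) (push-invL-cancel x (pushAll-reduced w r)))

pushAll-reduce : ∀ u {v} → Reduced v → pushAll u v ≡ pushAll (reduce u) v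
pushAll-reduce [] _ = refl
pushAll-reduce (x ∷ u) r = trans (cong (push x) (pushAll-reduce u r)) (sym (pushAll-push x (reduce u) r))

pushAll-⁻¹ : ∀ w {v} → Reduced v → pushAll (w ⁻¹) (pushAll w v) ≡ v
pushAll-⁻¹ [] _ = refl
pushAll-⁻¹ (x ∷ w) {v} r = begin
  pushAll ((x ∷ w) ⁻¹) (push x (pushAll w v))          ≡⟨ cong (λ u → pushAll u (push x (pushAll w v))) (⁻¹-∷ x w) ⟩
  pushAll (w ⁻¹ ++ [ invL x ]) (push x (pushAll w v))   ≡⟨ foldr-++ push _ (w ⁻¹) [ invL x ] ⟩
  pushAll (w ⁻¹) (push (invL x) (push x (pushAll w v))) ≡⟨ cong (pushAll (w ⁻¹)) cancel ⟩
  pushAll (w ⁻¹) (pushAll w v)                          ≡⟨ pushAll-⁻¹ w r ⟩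
  v                                                     ∎
  where
  open ≡-Reasoning
  cancel : push (invL x) (push x (pushAll w v)) ≡ pushAll w v
  cancel = subst (λ z → push (invL x) (push z (pushAll w v)) ≡ pushAll w v)
                 (invL-involutive x) (push-invL-cancel (invL x) (pushAll-reduced w r))

length-push : ∀ x w → length (push x w) ≤ suc (length w)
length-push x [] = ≤-refl
length-push x (y ∷ w) with inverseLetters x y
... | true  = m≤n⇒m≤1+n (n≤1+n (length w))
... | false = ≤-refl

length-reduce : ∀ w → length (reduce w) ≤ length w
length-reduce [] = z≤n
length-reduce (x ∷ w) = ≤-trans (length-push x (reduce w)) (s≤s (length-reduce w))

infix 4 _≃_
record _≃_ (u v : Word) : Set where
  constructor mk≃
  field reduce≡reduce : reduce u ≡ reduce v
open _≃_ public

≃-isEquivalence : IsEquivalence _≃_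
≃-isEquivalence = record
  { refl  = mk≃ refl
  ; sym   = λ u≃v → mk≃ (sym (reduce≡reduce u≃v))
  ; trans = λ u≃v v≃w → mk≃ (trans (reduce≡reduce u≃v) (reduce≡reduce v≃w))
  }

≃-setoid : Setoid 0ℓ 0ℓ
≃-setoid = record { isEquivalence = ≃-isEquivalence }

open IsEquivalence ≃-isEquivalence public
  using () renaming (refl to ≃-refl; sym to ≃-sym; trans to ≃-trans; reflexive to ≡⇒≃)

reduce-≃ : ∀ w → reduce w ≃ w
reduce-≃ w = mk≃ (reduced⇒reduce≡id (reduce-reduced w))

≃-reduced⇒reduce≡ : ∀ {u v} → u ≃ v → Reduced v → reduce u ≡ v
≃-reduced⇒reduce≡ u≃v r = trans (reduce≡reduce u≃v) (reduced⇒reduce≡id r)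

++-cong : ∀ {u u′ v v′} → u ≃ u′ → v ≃ v′ → u ++ v ≃ u′ ++ v′
++-cong {u} {u′} {v} {v′} (mk≃ u≃u′) (mk≃ v≃v′) = mk≃ (begin
  reduce (u ++ v)                 ≡⟨ reduce-++-reduce u v ⟩
  pushAll (reduce u) (reduce v)   ≡⟨ cong₂ pushAll u≃u′ v≃v′ ⟩
  pushAll (reduce u′) (reduce v′) ≡⟨ reduce-++-reduce u′ v′ ⟨
  reduce (u′ ++ v′)               ∎)
  where
  open ≡-Reasoning
  reduce-++-reduce : ∀ u v → reduce (u ++ v) ≡ pushAll (reduce u) (reduce v)
  reduce-++-reduce u v = trans (reduce-++ u v) (pushAll-reduce u (reduce-reduced v))

++-congˡ : ∀ u {v v′} → v ≃ v′ → u ++ v ≃ u ++ v′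
++-congˡ u = ++-cong (≃-refl {u})

++-congʳ : ∀ {u u′} v → u ≃ u′ → u ++ v ≃ u′ ++ v
++-congʳ v u≃u′ = ++-cong u≃u′ (≃-refl {v})

⁻¹-++-cancel : ∀ w → w ⁻¹ ++ w ≃ []
⁻¹-++-cancel w = mk≃ (trans (reduce-++ (w ⁻¹) w) (pushAll-⁻¹ w []))

++-⁻¹-cancel : ∀ w → w ++ w ⁻¹ ≃ []
++-⁻¹-cancel w = subst (λ u → u ++ w ⁻¹ ≃ []) (⁻¹-involutive w) (⁻¹-++-cancel (w ⁻¹))

cancel-inside : ∀ l {w} r → w ≃ [] → l ++ w ++ r ≃ l ++ r
cancel-inside l r w≃[] = ++-congˡ l (++-congʳ r w≃[])

conjugate-cancel : ∀ g v → g ⁻¹ ++ (g ++ v ++ g ⁻¹) ++ g ≃ v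
conjugate-cancel g v = begin
  g ⁻¹ ++ (g ++ v ++ g ⁻¹) ++ g             ≡⟨ solve (++-monoid Letter) ⟩
  [] ++ (g ⁻¹ ++ g) ++ v ++ (g ⁻¹ ++ g) ++ [] ≈⟨ cancel-inside [] _ (⁻¹-++-cancel g) ⟩
  v ++ (g ⁻¹ ++ g) ++ []                     ≈⟨ cancel-inside v [] (⁻¹-++-cancel g) ⟩
  v ++ []                                    ≡⟨ ++-identityʳ v ⟩
  v                                          ∎
  where open SetoidReasoning ≃-setoid

conjugate⁻¹-cancel : ∀ g v → g ++ (g ⁻¹ ++ v ++ g) ++ g ⁻¹ ≃ v
conjugate⁻¹-cancel g v =
  subst (λ u → u ++ (g ⁻¹ ++ v ++ u) ++ g ⁻¹ ≃ v) (⁻¹-involutive g) (conjugate-cancel (g ⁻¹) v)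

Commute : Word → Word → Set
Commute u v = u ++ v ≃ v ++ u

Commute-cong : ∀ {u u′ v v′} → u ≃ u′ → v ≃ v′ → Commute u v → Commute u′ v′
Commute-cong u≃u′ v≃v′ uv≃vu =
  ≃-trans (≃-sym (++-cong u≃u′ v≃v′)) (≃-trans uv≃vu (++-cong v≃v′ u≃u′))

Commute-conjugate : ∀ g {u v} → Commute u v → Commute (g ⁻¹ ++ u ++ g) (g ⁻¹ ++ v ++ g)
Commute-conjugate g {u} {v} uv≃vu = begin
  (g ⁻¹ ++ u ++ g) ++ (g ⁻¹ ++ v ++ g) ≈⟨ conjugate-++ u v ⟩
  g ⁻¹ ++ (u ++ v) ++ g                ≈⟨ ++-congˡ (g ⁻¹) (++-congʳ g uv≃vu) ⟩
  g ⁻¹ ++ (v ++ u) ++ g                ≈⟨ conjugate-++ v u ⟨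
  (g ⁻¹ ++ v ++ g) ++ (g ⁻¹ ++ u ++ g) ∎
  where
  open SetoidReasoning ≃-setoid
  conjugate-++ : ∀ u v → (g ⁻¹ ++ u ++ g) ++ (g ⁻¹ ++ v ++ g) ≃ g ⁻¹ ++ (u ++ v) ++ g
  conjugate-++ u v = begin
    (g ⁻¹ ++ u ++ g) ++ (g ⁻¹ ++ v ++ g) ≡⟨ solve (++-monoid Letter) ⟩
    (g ⁻¹ ++ u) ++ (g ++ g ⁻¹) ++ v ++ g ≈⟨ cancel-inside (g ⁻¹ ++ u) (v ++ g) (++-⁻¹-cancel g) ⟩
    (g ⁻¹ ++ u) ++ v ++ g                ≡⟨ solve (++-monoid Letter) ⟩
    g ⁻¹ ++ (u ++ v) ++ g                ∎

-- With c = g⁻¹P, c⁻¹yc = P⁻¹bP and s = P⁻¹aP are conjugates of b and a by P.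
conjugate-commutes-with-core : ∀ {a b g y} P s →
  a ≃ P ++ s ++ P ⁻¹ → Commute b a → y ≃ (g ⁻¹ ++ b) ++ g → Commute s ((g ⁻¹ ++ P) ⁻¹ ++ y ++ (g ⁻¹ ++ P))
conjugate-commutes-with-core {a} {b} {g} {y} P s a≃PsP⁻¹ ba≃ab y≃g⁻¹bg =
  Commute-cong (≃-sym s≃P⁻¹aP) (≃-sym c⁻¹yc≃P⁻¹bP) (≃-sym (Commute-conjugate P ba≃ab))
  where
  open SetoidReasoning ≃-setoid
  c g⁻¹bg : Word
  c = g ⁻¹ ++ P
  g⁻¹bg = g ⁻¹ ++ b ++ g
  c⁻¹yc≃P⁻¹bP : c ⁻¹ ++ y ++ c ≃ P ⁻¹ ++ b ++ P
  c⁻¹yc≃P⁻¹bP = begin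
    c ⁻¹ ++ y ++ c                          ≈⟨ ++-congˡ (c ⁻¹) (++-congʳ c y≃g⁻¹bg) ⟩
    c ⁻¹ ++ ((g ⁻¹ ++ b) ++ g) ++ c          ≡⟨ cong (λ Q → c ⁻¹ ++ Q ++ c) (++-assoc (g ⁻¹) b g) ⟩
    c ⁻¹ ++ g⁻¹bg ++ c                       ≡⟨ conjugate-by-++ (g ⁻¹) P g⁻¹bg ⟩
    P ⁻¹ ++ (g ⁻¹ ⁻¹ ++ g⁻¹bg ++ g ⁻¹) ++ P ≡⟨ cong (λ u → P ⁻¹ ++ (u ++ g⁻¹bg ++ g ⁻¹) ++ P) (⁻¹-involutive g) ⟩
    P ⁻¹ ++ (g ++ g⁻¹bg ++ g ⁻¹) ++ P        ≈⟨ ++-congˡ (P ⁻¹) (++-congʳ P (conjugate⁻¹-cancel g b)) ⟩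
    P ⁻¹ ++ b ++ P                           ∎
  s≃P⁻¹aP : s ≃ P ⁻¹ ++ a ++ P
  s≃P⁻¹aP = begin
    s                             ≈⟨ conjugate-cancel P s ⟨
    P ⁻¹ ++ (P ++ s ++ P ⁻¹) ++ P ≈⟨ ++-congˡ (P ⁻¹) (++-congʳ P a≃PsP⁻¹) ⟨
    P ⁻¹ ++ a ++ P                ∎

infixr 8 _^_
_^_ : Word → ℕ → Word
s ^ zero  = []
s ^ suc M = s ++ s ^ M

length-^ : ∀ s M → length (s ^ M) ≡ M * length s
length-^ s zero = refl
length-^ s (suc M) = trans (length-++ s) (cong (length s +_) (length-^ s M))

^-++-comm : ∀ s M → s ^ M ++ s ≡ s ++ s ^ M
^-++-comm s zero = sym (++-identityʳ s)
^-++-comm s (suc M) = trans (++-assoc s (s ^ M) s) (cong (s ++_) (^-++-comm s M))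

Commute-^ : ∀ {s w} → Commute s w → ∀ M → Commute (s ^ M) w
Commute-^ {s} {w} sw≃ws zero = ≡⇒≃ (sym (++-identityʳ w))
Commute-^ {s} {w} sw≃ws (suc M) = begin
  (s ++ s ^ M) ++ w ≡⟨ ++-assoc s (s ^ M) w ⟩
  s ++ s ^ M ++ w   ≈⟨ ++-congˡ s (Commute-^ sw≃ws M) ⟩
  s ++ w ++ s ^ M   ≡⟨ ++-assoc s w (s ^ M) ⟨
  (s ++ w) ++ s ^ M ≈⟨ ++-congʳ (s ^ M) sw≃ws ⟩
  (w ++ s) ++ s ^ M ≡⟨ ++-assoc w s (s ^ M) ⟩
  w ++ s ++ s ^ M   ∎
  where open SetoidReasoning ≃-setoid

record Cancellation (A B AB : Word) : Set where
  constructor cancellation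
  field
    A₁ C B₂ : Word
    A≡A₁C   : A ≡ A₁ ++ C
    B≡C⁻¹B₂ : B ≡ C ⁻¹ ++ B₂
    AB≡A₁B₂ : AB ≡ A₁ ++ B₂

push-cancellation : ∀ x {A B AB} → Reduced (x ∷ A) → Cancellation A B AB → Cancellation (x ∷ A) B (push x AB)
push-cancellation x r (cancellation (a ∷ A₁) C B₂ refl refl refl) =
  cancellation (x ∷ a ∷ A₁) C B₂ refl refl (push-noCancel (A₁ ++ B₂) (head r))
push-cancellation x r (cancellation [] C [] refl refl refl) = cancellation [ x ] C [] refl refl refl
push-cancellation x r (cancellation [] C (y ∷ B₂) refl refl refl) with inverseLetters x y in e
... | true  = cancellation [] (x ∷ C) B₂ refl C⁻¹yB₂≡ refl
  where
  C⁻¹yB₂≡ : C ⁻¹ ++ y ∷ B₂ ≡ (x ∷ C) ⁻¹ ++ B₂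
  C⁻¹yB₂≡ rewrite ⁻¹-∷ x C | inverseLetters⇒≡invL x y e = sym (++-assoc (C ⁻¹) [ invL x ] B₂)
... | false = cancellation [ x ] C (y ∷ B₂) refl refl refl

pushAll-cancellation : ∀ A {B} → Reduced A → Cancellation A B (pushAll A B)
pushAll-cancellation [] _ = cancellation [] [] _ refl refl refl
pushAll-cancellation (x ∷ A) r = push-cancellation x r (pushAll-cancellation A (tail r))

reduce-++-cancellation : ∀ {A B} → Reduced A → Reduced B → Cancellation A B (reduce (A ++ B))
reduce-++-cancellation {A} {B} rA rB = subst (Cancellation A B) pushAll≡reduce (pushAll-cancellation A rA)
  where
  pushAll≡reduce : pushAll A B ≡ reduce (A ++ B)
  pushAll≡reduce = sym (trans (reduce-++ A B) (cong (pushAll A) (reduced⇒reduce≡id rB)))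

-- Each cancellation, in S·w and in w·S, removes at most |w| letters of S; so
-- for |S| ≥ 2|w| the surviving head W₁ of w in w·S = W₁S₂ is also a prefix of
-- S·w = S₁W₂, hence of S.
commute-long⇒prefix·prefix⁻¹ : ∀ {S w} → Reduced S → Reduced w → length w + length w ≤ length S →
  Commute S w → ∃₂ λ π σ → w ≡ π ++ σ ⁻¹ × Prefix π S × Prefix σ S
commute-long⇒prefix·prefix⁻¹ {S} {w} rS rw long (mk≃ Sw≃wS)
  with reduce-++-cancellation rS rw | reduce-++-cancellation rw rS
... | cancellation S₁ C₁ W₂ S≡S₁C₁ w≡C₁⁻¹W₂ Sw≡ | cancellation W₁ C₂ S₂ w≡W₁C₂ S≡C₂⁻¹S₂ wS≡ =
  let m , S₁≡W₁m , _ = ++-split-≤ W₁ S₂ S₁ W₂ |W₁|≤|S₁| (sym S₁W₂≡W₁S₂)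
  in W₁ , C₂ ⁻¹ , w≡W₁C₂⁻¹⁻¹ ,
     (m ++ C₁ , trans S≡S₁C₁ (trans (cong (_++ C₁) S₁≡W₁m) (++-assoc W₁ m C₁))) ,
     (S₂ , S≡C₂⁻¹S₂)
  where
  |W₁|≤|w| : length W₁ ≤ length w
  |W₁|≤|w| = subst (λ u → length W₁ ≤ length u) (sym w≡W₁C₂) (length-++-≤ˡ W₁)
  |C₁|≤|w| : length C₁ ≤ length w
  |C₁|≤|w| = subst (λ u → length C₁ ≤ length u) (sym w≡C₁⁻¹W₂)
    (subst (_≤ length (C₁ ⁻¹ ++ W₂)) (length-⁻¹ C₁) (length-++-≤ˡ (C₁ ⁻¹)))
  |W₁|≤|S₁| : length W₁ ≤ length S₁
  |W₁|≤|S₁| = +-cancelʳ-≤ (length C₁) (length W₁) (length S₁) (begin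
    length W₁ + length C₁ ≤⟨ +-mono-≤ |W₁|≤|w| |C₁|≤|w| ⟩
    length w + length w   ≤⟨ long ⟩
    length S              ≡⟨ cong length S≡S₁C₁ ⟩
    length (S₁ ++ C₁)     ≡⟨ length-++ S₁ ⟩
    length S₁ + length C₁ ∎)
    where open ≤-Reasoning
  S₁W₂≡W₁S₂ : S₁ ++ W₂ ≡ W₁ ++ S₂
  S₁W₂≡W₁S₂ = trans (sym Sw≡) (trans Sw≃wS wS≡)
  w≡W₁C₂⁻¹⁻¹ : w ≡ W₁ ++ C₂ ⁻¹ ⁻¹
  w≡W₁C₂⁻¹⁻¹ = trans w≡W₁C₂ (cong (W₁ ++_) (sym (⁻¹-involutive C₂)))

Reduced-∷ʳ : ∀ u {x y} → Reduced (u ++ [ x ]) → NoCancel x y → Reduced ((u ++ [ x ]) ++ [ y ])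
Reduced-∷ʳ u {x} {y} r nc = subst Reduced (sym (++-assoc u [ x ] [ y ])) (Linked-glue u [] [ y ] r (nc ∷ [-]))

CyclicallyReduced : Word → Set
CyclicallyReduced t = Reduced (t ++ t)

cyclicallyReduced⇒reduced : ∀ {t} → CyclicallyReduced t → Reduced t
cyclicallyReduced⇒reduced {t} = Linked-++⁻ˡ t

cyclicallyReduced-rotate : ∀ A B → CyclicallyReduced (A ++ B) → CyclicallyReduced (B ++ A)
cyclicallyReduced-rotate A B c = Linked-infix A ((B ++ A) ++ (B ++ A)) (subst Reduced cube≡ (cube (A ++ B) c))
  where
  cube : ∀ t → CyclicallyReduced t → Reduced (t ++ t ++ t)
  cube [] _ = []
  cube t@(y ∷ v) c = Linked-glue t v t c c
  cube≡ : (A ++ B) ++ (A ++ B) ++ (A ++ B) ≡ A ++ ((B ++ A) ++ (B ++ A)) ++ B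
  cube≡ = solve (++-monoid Letter)

^-reduced : ∀ {s} → CyclicallyReduced s → ∀ M → Reduced (s ^ M)
^-reduced {[]} c zero = []
^-reduced {[]} c (suc M) = ^-reduced c M
^-reduced {y ∷ v} c zero = []
^-reduced {s@(y ∷ v)} c (suc zero) = subst Reduced (sym (++-identityʳ s)) (Linked-++⁻ˡ s c)
^-reduced {s@(y ∷ v)} c (suc (suc M)) = Linked-glue s v (s ^ M) c (^-reduced c (suc M))

cyclic-decomposition : ∀ {v} → Reduced v → ∃₂ λ P u → v ≡ P ++ u ++ P ⁻¹ × CyclicallyReduced u
cyclic-decomposition {v} = decompose (length v) v ≤-refl
  where
  decompose : ∀ n v → length v ≤ n → Reduced v → ∃₂ λ P u → v ≡ P ++ u ++ P ⁻¹ × CyclicallyReduced u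
  decompose n [] _ _ = [] , [] , refl , []
  decompose n (x ∷ v) _ r with initLast v
  ... | [] = [] , [ x ] , refl , inverseLetters-irrefl x ∷ [-]
  ... | m ∷ʳ′ z with inverseLetters z x in e
  ...   | false = [] , x ∷ m ++ [ z ] , sym (++-identityʳ _) ,
                  subst Reduced x∷m∷z² (Linked-glue (x ∷ m) [] _ r (e ∷ r))
    where
    x∷m∷z² : (x ∷ m) ++ z ∷ [] ++ (x ∷ m ++ [ z ]) ≡ (x ∷ m ++ [ z ]) ++ (x ∷ m ++ [ z ])
    x∷m∷z² = cong (x ∷_) (solve (++-monoid Letter))
  decompose (suc n) (x ∷ _) (s≤s |v|≤n) r | m ∷ʳ′ z | true
    with decompose n m |m|≤n (Linked-infix [ x ] m r)
    where
    |m|≤n : length m ≤ n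
    |m|≤n = ≤-trans (≤-trans (m≤m+n (length m) 1) (≤-reflexive (sym (length-++ m)))) |v|≤n
  ... | P , u , refl , c = x ∷ P , u , x∷PuP⁻¹z≡ , c
    where
    x∷PuP⁻¹z≡ : x ∷ (P ++ u ++ P ⁻¹) ++ [ z ] ≡ (x ∷ P) ++ u ++ (x ∷ P) ⁻¹
    x∷PuP⁻¹z≡ rewrite ⁻¹-∷ x P | inverseLetters⇒≡invL z x e | invL-involutive z =
      cong (invL z ∷_) (solve (++-monoid Letter))

reduced-++-⁻¹⇒[] : ∀ P → Reduced (P ++ P ⁻¹) → P ≡ []
reduced-++-⁻¹⇒[] P r with initLast P
... | [] = refl
... | P₀ ∷ʳ′ y = contradiction (trans (sym y≁y⁻¹) (inverseLetters-invL y)) λ ()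
  where
  PP⁻¹≡ : (P₀ ++ [ y ]) ++ (P₀ ++ [ y ]) ⁻¹ ≡ P₀ ++ (y ∷ invL y ∷ []) ++ P₀ ⁻¹
  PP⁻¹≡ rewrite ⁻¹-++ P₀ [ y ] = solve (++-monoid Letter)
  y≁y⁻¹ : NoCancel y (invL y)
  y≁y⁻¹ = head (Linked-infix P₀ (y ∷ invL y ∷ []) (subst Reduced PP⁻¹≡ r))

RotationInvariant : (Word → Set) → Set
RotationInvariant I = ∀ A B → I (A ++ B) → I (B ++ A)

record CyclicForm (I : Word → Set) (v : Word) : Set where
  constructor cyclicForm
  field
    prefix core    : Word
    decomposition  : v ≡ prefix ++ core ++ prefix ⁻¹
    reduced        : Reduced v
    cyclic         : CyclicallyReduced core
    core-satisfies : I core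

module _ {I : Word → Set} (rotate : RotationInvariant I) where

  rotated-core : ∀ A B {w} → CyclicallyReduced (A ++ B) → I (A ++ B) → w ≃ B ++ A → CyclicForm I (reduce w)
  rotated-core A B {w} c i w≃BA =
    cyclicForm [] (B ++ A)
      (trans (≃-reduced⇒reduce≡ w≃BA (cyclicallyReduced⇒reduced c′)) (sym (++-identityʳ _)))
      (reduce-reduced w) c′ (rotate A B i)
    where
    c′ : CyclicallyReduced (B ++ A)
    c′ = cyclicallyReduced-rotate A B c

  conjugate-without-cancellation : ∀ {ℓ v} → CyclicForm I v → Reduced ([ ℓ ] ⁻¹ ++ v ++ [ ℓ ]) →
    CyclicForm I (reduce ([ ℓ ] ⁻¹ ++ v ++ [ ℓ ]))
  conjugate-without-cancellation {ℓ} (cyclicForm P t refl _ c i) r =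
    cyclicForm (invL ℓ ∷ P) t (trans (reduced⇒reduce≡id r) ℓ⁻¹PtP⁻¹ℓ≡)
               (reduce-reduced ([ ℓ ] ⁻¹ ++ (P ++ t ++ P ⁻¹) ++ [ ℓ ])) c i
    where
    ℓ⁻¹PtP⁻¹ℓ≡ : invL ℓ ∷ (P ++ t ++ P ⁻¹) ++ [ ℓ ] ≡ (invL ℓ ∷ P) ++ t ++ (invL ℓ ∷ P) ⁻¹
    ℓ⁻¹PtP⁻¹ℓ≡ rewrite ⁻¹-∷ (invL ℓ) P | invL-involutive ℓ =
      cong (invL ℓ ∷_) (solve (++-monoid Letter))

  conjugate-cyclic-by-letter : ∀ ℓ {t} → CyclicallyReduced t → I t →
    CyclicForm I (reduce ([ ℓ ] ⁻¹ ++ t ++ [ ℓ ]))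
  conjugate-cyclic-by-letter ℓ {[]} c i = rotated-core [] [] c i (⁻¹-++-cancel [ ℓ ])
  conjugate-cyclic-by-letter ℓ {y ∷ t} c i with inverseLetters (invL ℓ) y in e
  ... | true with trans (inverseLetters⇒≡invL (invL ℓ) y e) (invL-involutive ℓ)
  ...   | refl = rotated-core [ y ] t c i (cancel-inside [] (t ++ [ y ]) (⁻¹-++-cancel [ y ]))
  conjugate-cyclic-by-letter ℓ {y ∷ t} c i | false with ∷-∷ʳ y t
  ... | t₁ , z , y∷t≡t₁z with inverseLetters z ℓ in e′
  ...   | false = conjugate-without-cancellation (cyclicForm [] (y ∷ t) (sym (++-identityʳ _)) r c i)
                    (e ∷ subst (λ u → Reduced (u ++ [ ℓ ])) (sym y∷t≡t₁z) (Reduced-∷ʳ t₁ r′ e′))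
    where
    r : Reduced (y ∷ t)
    r = cyclicallyReduced⇒reduced c
    r′ : Reduced (t₁ ++ [ z ])
    r′ = subst Reduced y∷t≡t₁z r
  ...   | true with inverseLetters⇒≡invL z ℓ e′
  ...     | refl = rotated-core t₁ [ z ] (subst CyclicallyReduced y∷t≡t₁z c) (subst I y∷t≡t₁z i) (begin
    [ invL z ] ⁻¹ ++ (y ∷ t) ++ [ invL z ]             ≡⟨ cong (λ u → [ invL z ] ⁻¹ ++ u ++ [ invL z ]) y∷t≡t₁z ⟩
    [ invL z ] ⁻¹ ++ (t₁ ++ [ z ]) ++ [ invL z ]       ≡⟨ cong (invL (invL z) ∷_) (++-assoc t₁ [ z ] [ invL z ]) ⟩
    ([ invL z ] ⁻¹ ++ t₁) ++ ([ z ] ++ [ z ] ⁻¹) ++ [] ≈⟨ cancel-inside _ [] (++-⁻¹-cancel [ z ]) ⟩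
    ([ invL z ] ⁻¹ ++ t₁) ++ []                        ≡⟨ ++-identityʳ _ ⟩
    invL (invL z) ∷ t₁                                 ≡⟨ cong (_∷ t₁) (invL-involutive z) ⟩
    [ z ] ++ t₁                                        ∎)
    where open SetoidReasoning ≃-setoid

  conjugate-by-letter : ∀ ℓ {v} → CyclicForm I v → CyclicForm I (reduce ([ ℓ ] ⁻¹ ++ v ++ [ ℓ ]))
  conjugate-by-letter ℓ (cyclicForm [] t refl _ c i) =
    subst (λ v → CyclicForm I (reduce ([ ℓ ] ⁻¹ ++ v ++ [ ℓ ]))) (sym (++-identityʳ t))
      (conjugate-cyclic-by-letter ℓ c i)
  conjugate-by-letter ℓ f@(cyclicForm (y ∷ P) t refl r c i) with inverseLetters (invL ℓ) y in e
  ... | false = conjugate-without-cancellation f (e ∷ subst (λ u → Reduced (u ++ [ ℓ ])) (sym (∷-conjugate y P t))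
                                                     (Reduced-∷ʳ (y ∷ P ++ t ++ P ⁻¹) r′ (NoCancel-invL-swap ℓ y e)))
    where
    r′ : Reduced ((y ∷ P ++ t ++ P ⁻¹) ++ [ invL y ])
    r′ = subst Reduced (∷-conjugate y P t) r
  ... | true with trans (inverseLetters⇒≡invL (invL ℓ) y e) (invL-involutive ℓ)
  ...   | refl = subst (CyclicForm I) (sym (≃-reduced⇒reduce≡ w≃Q rQ)) (cyclicForm P t refl rQ c i)
    where
    Q : Word
    Q = P ++ t ++ P ⁻¹
    rQ : Reduced Q
    rQ = Linked-infix [ y ] Q (subst Reduced (trans (∷-conjugate y P t) (++-assoc [ y ] Q [ invL y ])) r)
    w≃Q : [ y ] ⁻¹ ++ (y ∷ P ++ t ++ (y ∷ P) ⁻¹) ++ [ y ] ≃ Q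
    w≃Q = subst (λ u → [ y ] ⁻¹ ++ u ++ [ y ] ≃ Q) (sym (∷-conjugate y P t)) (conjugate-cancel [ y ] Q)

  conjugate : ∀ g {v} → CyclicForm I v → CyclicForm I (reduce (g ⁻¹ ++ v ++ g))
  conjugate [] {v} f@(cyclicForm _ _ _ r _ _) =
    subst (CyclicForm I) (sym (trans (cong reduce (++-identityʳ v)) (reduced⇒reduce≡id r))) f
  conjugate (ℓ ∷ g) {v} f =
    subst (CyclicForm I) (sym (reduce≡reduce g⁻¹ℓ⁻¹vℓg≃)) (conjugate g (conjugate-by-letter ℓ f))
    where
    open SetoidReasoning ≃-setoid
    g⁻¹ℓ⁻¹vℓg≃ : (ℓ ∷ g) ⁻¹ ++ v ++ ℓ ∷ g ≃ g ⁻¹ ++ reduce ([ ℓ ] ⁻¹ ++ v ++ [ ℓ ]) ++ g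
    g⁻¹ℓ⁻¹vℓg≃ = begin
      (ℓ ∷ g) ⁻¹ ++ v ++ ℓ ∷ g                      ≡⟨ cong (_++ v ++ ℓ ∷ g) (⁻¹-∷ ℓ g) ⟩
      (g ⁻¹ ++ [ invL ℓ ]) ++ v ++ ℓ ∷ g              ≡⟨ ++-assoc (g ⁻¹) [ invL ℓ ] (v ++ ℓ ∷ g) ⟩
      g ⁻¹ ++ invL ℓ ∷ v ++ ℓ ∷ g                    ≡⟨ cong (λ u → g ⁻¹ ++ invL ℓ ∷ u) (++-assoc v [ ℓ ] g) ⟨
      g ⁻¹ ++ ([ ℓ ] ⁻¹ ++ v ++ [ ℓ ]) ++ g           ≈⟨ ++-congˡ (g ⁻¹) (++-congʳ g (reduce-≃ _)) ⟨
      g ⁻¹ ++ reduce ([ ℓ ] ⁻¹ ++ v ++ [ ℓ ]) ++ g    ∎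

infix-of-power⇒All : ∀ {P : Letter → Set} s M {X} →
  Infix X (s ^ M) → length s ≤ length X → All P X → All P s
infix-of-power⇒All s M (l , r , eq) s≤X pX = go s M l _ r eq pX s≤X
  where
  go : ∀ {P : Letter → Set} s M l X r → s ^ M ≡ l ++ X ++ r → All P X → length s ≤ length X → All P s
  go [] M l X r _ _ _ = []
  go (_ ∷ _) zero [] [] r _ _ ()
  go (_ ∷ _) zero [] (_ ∷ _) r () _ _
  go (_ ∷ _) zero (_ ∷ _) X r () _ _
  go s (suc M) l X r eq cX s≤X with ++-split s (s ^ M) l (X ++ r) eq
  ... | inj₁ (m , _ , s^M≡) = go s M m X r s^M≡ cX s≤X
  ... | inj₂ (m , refl , Xr≡ms^M) = All.++⁺ (All.++⁻ʳ m cml) (All.++⁻ˡ m cml)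
    where
    cml : All _ (m ++ l)
    cml = All-prefix (m ++ l) (begin
      (m ++ l) ++ m ++ s ^ M ≡⟨ ++-assoc m l (m ++ s ^ M) ⟩
      m ++ l ++ m ++ s ^ M   ≡⟨ cong (m ++_) (++-assoc l m (s ^ M)) ⟨
      m ++ s ++ s ^ M        ≡⟨ cong (m ++_) (^-++-comm s M) ⟨
      m ++ s ^ M ++ s        ≡⟨ ++-assoc m (s ^ M) s ⟨
      (m ++ s ^ M) ++ s      ≡⟨ cong (_++ s) Xr≡ms^M ⟨
      (X ++ r) ++ s          ≡⟨ ++-assoc X r s ⟩
      X ++ r ++ s            ∎) (≤-trans (≤-reflexive (length-++-comm m l)) s≤X) cX
      where open ≡-Reasoning

Infix-⁻¹ : ∀ {X σ} → Infix X (σ ⁻¹) → Infix (X ⁻¹) σ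
Infix-⁻¹ {X} {σ} (l , r , σ⁻¹≡) = r ⁻¹ , l ⁻¹ , (begin
  σ                    ≡⟨ ⁻¹-involutive σ ⟨
  σ ⁻¹ ⁻¹              ≡⟨ cong _⁻¹ σ⁻¹≡ ⟩
  (l ++ X ++ r) ⁻¹     ≡⟨ ⁻¹-++ l (X ++ r) ⟩
  (X ++ r) ⁻¹ ++ l ⁻¹  ≡⟨ cong (_++ l ⁻¹) (⁻¹-++ X r) ⟩
  (r ⁻¹ ++ X ⁻¹) ++ l ⁻¹ ≡⟨ ++-assoc (r ⁻¹) (X ⁻¹) (l ⁻¹) ⟩
  r ⁻¹ ++ X ⁻¹ ++ l ⁻¹ ∎)
  where open ≡-Reasoning

OnGenerator : Fin 2 → Letter → Set
OnGenerator i x = proj₁ x ≡ i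

All-OnGenerator-⁻¹ : ∀ {i} w → All (OnGenerator i) w → All (OnGenerator i) (w ⁻¹)
All-OnGenerator-⁻¹ [] _ = []
All-OnGenerator-⁻¹ (x ∷ w) (px ∷ pw) =
  subst (All _) (sym (⁻¹-∷ x w)) (All.++⁺ (All-OnGenerator-⁻¹ w pw) (px ∷ []))

-- One of the two halves of a run of length 2k lies inside π or inside σ⁻¹.
run-in-prefix·prefix⁻¹ : ∀ {k s} M {π σ} c l r → length s ≤ k → Prefix π (s ^ M) → Prefix σ (s ^ M) →
  l ++ replicate (k + k) c ++ r ≡ π ++ σ ⁻¹ → All (OnGenerator (proj₁ c)) s
run-in-prefix·prefix⁻¹ {k} {s} M {π} {σ} c l r s≤k π≤ σ≤ eq
  with Infix-++-split l (replicate k c) (replicate k c) r π (σ ⁻¹)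
         (trans (cong (l ++_) (sym (trans (cong (_++ r) (replicate-+ k k c)) (++-assoc (replicate k c) _ r)))) eq)
... | inj₁ inπ = infix-of-power⇒All s M (Infix-prefix inπ π≤)
                   (≤-trans s≤k (≤-reflexive (sym (length-replicate k))))
                   (All.replicate⁺ k refl)
... | inj₂ inσ⁻¹ = infix-of-power⇒All s M (Infix-prefix (Infix-⁻¹ inσ⁻¹) σ≤)
                     (≤-trans s≤k (≤-reflexive (sym (trans (length-⁻¹ (replicate k c)) (length-replicate k)))))
                     (All-OnGenerator-⁻¹ (replicate k c) (All.replicate⁺ k refl))

commute-with-run⇒OnGenerator : ∀ {k s w} c → CyclicallyReduced s → length s ≤ k → Reduced w → Commute s w →
  Infix (replicate (k + k) c) w → All (OnGenerator (proj₁ c)) s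
commute-with-run⇒OnGenerator {s = []} _ _ _ _ _ _ = []
commute-with-run⇒OnGenerator {k} {s@(_ ∷ _)} {w} c cs |s|≤k rw sw (l , r , w≡lcr) =
  let π , σ , w≡πσ⁻¹ , π≤ , σ≤ = commute-long⇒prefix·prefix⁻¹ (^-reduced cs M) rw long (Commute-^ sw M)
  in run-in-prefix·prefix⁻¹ M c l r |s|≤k π≤ σ≤ (trans (sym w≡lcr) w≡πσ⁻¹)
  where
  M : ℕ
  M = length w + length w
  long : M ≤ length (s ^ M)
  long = ≤-trans (m≤m*n M (length s)) (≤-reflexive (sym (length-^ s M)))

α β : Letter
α = zero , true
β = suc zero , true

block : ℕ → Word
block k = replicate (k + k) α ++ replicate (k + k) β

-- The prefix α^K and suffix β^K are buffers: with K > |h| they absorb all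
-- cancellation against h⁻¹ and keep the conjugating part of h⁻¹·witness
-- away from the two blocks.
witness : ℕ → ℕ → Word
witness k K = replicate K α ++ block k ++ block k ++ replicate K β

HasRuns : ℕ → Word → Set
HasRuns k z = Infix (replicate (k + k) α) z × Infix (replicate (k + k) β) z

EveryRotation : (Word → Set) → Word → Set
EveryRotation P t = ∀ A B → t ≡ A ++ B → P (B ++ A)

EveryRotation-invariant : ∀ P → RotationInvariant (EveryRotation P)
EveryRotation-invariant P A B rotations C D BA≡CD with ++-split B A C D BA≡CD
... | inj₁ (m , refl , refl) = subst P (++-assoc D B m) (rotations m (D ++ B) (++-assoc m D B))
... | inj₂ (m , refl , refl) = subst P (sym (++-assoc m A C)) (rotations (A ++ C) m (sym (++-assoc A C m)))

block-infix⇒HasRuns : ∀ k {z} → Infix (block k) z → HasRuns k z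
block-infix⇒HasRuns k (l , r , refl) =
  (l , replicate (k + k) β ++ r , solve (++-monoid Letter)) ,
  (l ++ replicate (k + k) α , r , solve (++-monoid Letter))

-- a cut of the cyclic word spares one of the two blocks
block²-infix⇒EveryRotation-HasRuns : ∀ k {u} → Infix (block k ++ block k) u → EveryRotation (HasRuns k) u
block²-infix⇒EveryRotation-HasRuns k (l , r , refl) A B u≡AB
  with ++-split A B (l ++ block k) (block k ++ r) (trans (sym u≡AB) (solve (++-monoid Letter)))
... | inj₁ (m , _ , refl) =
  block-infix⇒HasRuns k (m , r ++ A , trans (++-assoc m _ A) (cong (m ++_) (++-assoc (block k) r A)))
... | inj₂ (m , refl , _) =
  block-infix⇒HasRuns k (B ++ l , m , trans (cong (B ++_) (++-assoc l (block k) m)) (sym (++-assoc B l _)))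

Positive : Word → Set
Positive = All (λ x → proj₂ x ≡ true)

positive⇒reduced : ∀ {w} → Positive w → Reduced w
positive⇒reduced [] = []
positive⇒reduced (_ ∷ []) = [-]
positive⇒reduced {(i , _) ∷ (j , _) ∷ w} (refl ∷ p@(refl ∷ _)) = ∧-zeroʳ _ ∷ positive⇒reduced p

witness-positive : ∀ k K → Positive (witness k K)
witness-positive k K =
  All.++⁺ (All.replicate⁺ K refl) (All.++⁺ block⁺ (All.++⁺ block⁺ (All.replicate⁺ K refl)))
  where
  block⁺ : Positive (block k)
  block⁺ = All.++⁺ (All.replicate⁺ (k + k) refl) (All.replicate⁺ (k + k) refl)

reduce-h⁻¹-witness : ∀ k {K} h → length h < K → ∃₂ λ A m →
  reduce (h ⁻¹ ++ witness k K) ≡ A ++ m ++ block k ++ block k ++ replicate K β × length A < K × Positive m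
reduce-h⁻¹-witness k {K} h |h|<K
  with reduce-++-cancellation (reduce-reduced (h ⁻¹)) (positive⇒reduced (witness-positive k K))
... | cancellation A C B₂ h⁻¹≡AC x≡C⁻¹B₂ hx≡AB₂
  with ++-split-≤ (C ⁻¹) B₂ (replicate K α) _ |C⁻¹|≤K (sym x≡C⁻¹B₂) | |AC|≤|h|
  where
  |AC|≤|h| : length A + length C ≤ length h
  |AC|≤|h| = begin
    length A + length C    ≡⟨ length-++ A ⟨
    length (A ++ C)        ≡⟨ cong length h⁻¹≡AC ⟨
    length (reduce (h ⁻¹)) ≤⟨ length-reduce (h ⁻¹) ⟩
    length (h ⁻¹)          ≡⟨ length-⁻¹ h ⟩
    length h               ∎
    where open ≤-Reasoning
  |C⁻¹|≤K : length (C ⁻¹) ≤ length (replicate K α)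
  |C⁻¹|≤K = begin
    length (C ⁻¹)          ≡⟨ length-⁻¹ C ⟩
    length C               ≤⟨ ≤-trans (m≤n+m (length C) (length A)) (≤-trans |AC|≤|h| (<⇒≤ |h|<K)) ⟩
    K                      ≡⟨ length-replicate K ⟨
    length (replicate K α) ∎
    where open ≤-Reasoning
... | m , αᴷ≡C⁻¹m , B₂≡ | |AC|≤|h| = A , m , reduce-h⁻¹x≡ , |A|<K , m⁺
  where
  |A|<K : length A < K
  |A|<K = ≤-<-trans (≤-trans (m≤m+n (length A) (length C)) |AC|≤|h|) |h|<K
  m⁺ : Positive m
  m⁺ = All.++⁻ʳ (C ⁻¹) (subst Positive αᴷ≡C⁻¹m (All.replicate⁺ K refl))
  reduce-h⁻¹x≡ : reduce (h ⁻¹ ++ witness k K) ≡ A ++ m ++ block k ++ block k ++ replicate K β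
  reduce-h⁻¹x≡ = begin
    reduce (h ⁻¹ ++ witness k K)          ≡⟨ reduce≡reduce (++-congʳ (witness k K) (reduce-≃ (h ⁻¹))) ⟨
    reduce (reduce (h ⁻¹) ++ witness k K) ≡⟨ hx≡AB₂ ⟩
    A ++ B₂                               ≡⟨ cong (A ++_) B₂≡ ⟩
    A ++ m ++ block k ++ block k ++ replicate K β ∎
    where open ≡-Reasoning

-- Otherwise P⁻¹, a tail of the positive word Z, would contain the inverse of
-- the first letter of Z.
prefix-≤-nonpositive-head : ∀ A {Z P u} → A ++ Z ≡ P ++ u ++ P ⁻¹ → Positive Z → length P ≤ length A
prefix-≤-nonpositive-head A {Z} {P} {u} eq Z⁺ with length P ≤? length A
... | yes |P|≤|A| = |P|≤|A|
... | no |P|≰|A| with ++-split-≤ A Z P (u ++ P ⁻¹) (<⇒≤ (≰⇒> |P|≰|A|)) eq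
...   | [] , refl , _ = contradiction (≤-reflexive (cong length (++-identityʳ A))) |P|≰|A|
...   | y ∷ m , refl , refl = contradiction (trans (sym (cong not (All.head Z⁺))) invL-y⁺) λ ()
  where
  Z≡ : y ∷ m ++ u ++ (A ++ y ∷ m) ⁻¹ ≡ (y ∷ m ++ u ++ m ⁻¹) ++ [ invL y ] ++ A ⁻¹
  Z≡ rewrite ⁻¹-++ A (y ∷ m) | ⁻¹-∷ y m = cong (y ∷_) (solve (++-monoid Letter))
  invL-y⁺ : proj₂ (invL y) ≡ true
  invL-y⁺ = All.head (All-infix (y ∷ m ++ u ++ m ⁻¹ , A ⁻¹ , Z≡) Z⁺)

buffered-blocks⇒cyclicForm : ∀ k {K y} A m → Reduced y → y ≡ A ++ m ++ block k ++ block k ++ replicate K β →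
  length A < K → Positive m → CyclicForm (EveryRotation (HasRuns k)) y
buffered-blocks⇒cyclicForm k {K} A m ry y≡AZ |A|<K m⁺ with cyclic-decomposition ry
... | P , u , y≡PuP⁻¹ , cu
  with ++-split-≤ P (u ++ P ⁻¹) A Z (prefix-≤-nonpositive-head A {P = P} (trans (sym y≡AZ) y≡PuP⁻¹) Z⁺)
         (trans (sym y≡PuP⁻¹) y≡AZ)
  where
  Z : Word
  Z = m ++ block k ++ block k ++ replicate K β
  Z⁺ : Positive Z
  Z⁺ = All.++⁺ m⁺ (All.++⁻ʳ (replicate K α) (witness-positive k K))
... | A′ , refl , uP⁻¹≡A′Z
  with ++-split-≤ʳ u (P ⁻¹) (A′ ++ m ++ block k ++ block k) (replicate K β) |P⁻¹|≤K
         (trans uP⁻¹≡A′Z (solve (++-monoid Letter)))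
  where
  |P⁻¹|≤K : length (P ⁻¹) ≤ length (replicate K β)
  |P⁻¹|≤K = begin
    length (P ⁻¹)          ≡⟨ length-⁻¹ P ⟩
    length P               ≤⟨ length-++-≤ˡ P ⟩
    length (P ++ A′)       ≤⟨ <⇒≤ |A|<K ⟩
    K                      ≡⟨ length-replicate K ⟨
    length (replicate K β) ∎
    where open ≤-Reasoning
... | m₃ , _ , u≡ = cyclicForm P u y≡PuP⁻¹ ry cu
                      (block²-infix⇒EveryRotation-HasRuns k (A′ ++ m , m₃ , trans u≡ (solve (++-monoid Letter))))

witness-cyclicForm : ∀ k {K} h → length h < K →
  CyclicForm (EveryRotation (HasRuns k)) (reduce (h ⁻¹ ++ witness k K))
witness-cyclicForm k {K} h |h|<K =
  let A , m , y≡ , |A|<K , m⁺ = reduce-h⁻¹-witness k h |h|<K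
  in buffered-blocks⇒cyclicForm k A m (reduce-reduced (h ⁻¹ ++ witness k K)) y≡ |A|<K m⁺

witness-not-in-conjugate-of-centralizer : ∀ {a} → ¬ reduce a ≡ [] → ∀ {K} h → length h < K → ∀ g b →
  Commute b a → ¬ (h ⁻¹ ++ witness (length (reduce a)) K ≃ (g ⁻¹ ++ b) ++ g)
witness-not-in-conjugate-of-centralizer {a} a≢1 {K} h |h|<K g b ba≃ab y≃ with cyclic-decomposition (reduce-reduced a)
... | P , [] , a₀≡PP⁻¹ , _ = a≢1 (trans a₀≡PP⁻¹ (cong (λ Q → Q ++ Q ⁻¹) P≡[]))
  where
  P≡[] : P ≡ []
  P≡[] = reduced-++-⁻¹⇒[] P (subst Reduced a₀≡PP⁻¹ (reduce-reduced a))
... | P , s@(x ∷ _) , a₀≡PsP⁻¹ , cs = contradiction (trans (sym x-on-α) x-on-β) λ ()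
  where
  k : ℕ
  k = length (reduce a)
  y₀ c w : Word
  y₀ = reduce (h ⁻¹ ++ witness k K)
  c = g ⁻¹ ++ P
  w = reduce (c ⁻¹ ++ y₀ ++ c)
  sw : Commute s w
  sw = Commute-cong ≃-refl (≃-sym (reduce-≃ (c ⁻¹ ++ y₀ ++ c)))
         (conjugate-commutes-with-core {g = g} P s (≃-trans (≃-sym (reduce-≃ a)) (≡⇒≃ a₀≡PsP⁻¹)) ba≃ab
                                       (≃-trans (reduce-≃ (h ⁻¹ ++ witness k K)) y≃))
  |s|≤k : length s ≤ k
  |s|≤k = subst (length s ≤_) (cong length (sym a₀≡PsP⁻¹))
            (≤-trans (length-++-≤ˡ s) (length-++-≤ʳ (s ++ P ⁻¹) {P}))
  F : CyclicForm (EveryRotation (HasRuns k)) w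
  F = conjugate (EveryRotation-invariant (HasRuns k)) c (witness-cyclicForm k h |h|<K)
  open CyclicForm F
  runs : HasRuns k core
  runs = core-satisfies core [] (sym (++-identityʳ core))
  in-w : ∀ {X} → Infix X core → Infix X w
  in-w X-in-core = subst (Infix _) (sym decomposition) (Infix-++⁺ prefix (prefix ⁻¹) X-in-core)
  on-generator : ∀ ℓ → Infix (replicate (k + k) ℓ) w → All (OnGenerator (proj₁ ℓ)) s
  on-generator ℓ = commute-with-run⇒OnGenerator ℓ cs |s|≤k (reduce-reduced (c ⁻¹ ++ y₀ ++ c)) sw
  x-on-α : proj₁ x ≡ zero
  x-on-α = All.head (on-generator α (in-w (proj₁ runs)))
  x-on-β : proj₁ x ≡ suc zero
  x-on-β = All.head (on-generator β (in-w (proj₂ runs)))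

finite-family-bounded : ∀ {n} (f : Fin n → ℕ) → ∃ λ K → ∀ i → f i < K
finite-family-bounded {zero} f = 0 , λ ()
finite-family-bounded {suc n} f with finite-family-bounded (f ∘ suc)
... | K , f∘suc<K =
  suc (f zero) ⊔ K , λ { zero → m≤m⊔n _ K ; (suc i) → ≤-trans (f∘suc<K i) (m≤n⊔m (suc (f zero)) K) }

F₂-centralizerConjugatesNotCovered : ∀ n → CentralizerConjugatesNotCovered F₂ n
F₂-centralizerConjugatesNotCovered n a a≢1 h cover with finite-family-bounded (length ∘ h)
... | K , |h|<K = cover (witness (length (reduce a)) K) λ (i , g , b , ba≡ab , y≡g⁻¹bg) →
  witness-not-in-conjugate-of-centralizer a≢1 (h i) (|h|<K i) g b (mk≃ ba≡ab) (mk≃ y≡g⁻¹bg)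

lemma2p12 : ∀ {c ℓ} (G : Group c ℓ) → ModelOfTfg G →
    (a : Group.Carrier G) → ¬ (Group._≈_ G a (Group.ε G)) →
    ¬ Generic G (UnionOfConjugates G (Centralizer G a))
lemma2p12 G G≡F₂ a a≉1 (n , h , cover) =
  Equivalence.to (⊨Ψ⇔CentralizerConjugatesNotCovered (groupStructure G) n) G⊨Ψ a a≉1 h cover
  where
  G⊨Ψ : Semantics._⊨_ (groupStructure G) (Ψ n)
  G⊨Ψ = Equivalence.from (G≡F₂ (Ψ n))
          (Equivalence.from (⊨Ψ⇔CentralizerConjugatesNotCovered F₂ n) (F₂-centralizerConjugatesNotCovered n))
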